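{- Let $M=(E,\mathcal{B}_M)$ be a block matroid. The following are equivalent: (i) there is a matroid $N$ on $E$ whose set of bases equals the set $\mathcal{B}_M\cap\mathcal{B}_{M^\ast}$ of base-cobases of $M$ (so $G(M,M^\ast)=G(N)$); (ii) $G(M,M^\ast)$ is the $1$-skeleton of the polytope $P_{M,M^\ast}$ (identifying each base-cobase $B$ with its incidence vector $x_B$); (iii) there exists an identically self-dual matroid $N$ on $E$ such that $\mathcal{B}_N\subseteq\mathcal{B}_M$ and $\mathcal{B}_N\cap\mathcal{B}_{N^\ast}=\mathcal{B}_M\cap\mathcal{B}_{M^\ast}$.
   Context: For a matroid $M$ on $E$ with bases $\mathcal{B}_M$, the dual $M^\ast$ has bases $\mathcal{B}_{M^\ast}=\{E\setminus B: B\in\mathcal{B}_M\}$. $M$ is a block matroid if $\mathcal{B}_M\cap\mathcal{B}_{M^\ast}\neq\emptyset$; elements of this set are base-cobases. The base graph $G(N)$ has vertex set the bases of $N$, two adjacent iff their symmetric difference has size $2$; $G(M,M^\ast)$ is the subgraph of $G(M)$ induced by the base-cobases. $x_B\in\{0,1\}^E$ is the incidence vector of $B$, and $P_{M,M^\ast}=\mathrm{conv}\{x_B: B\in\mathcal{B}_M\cap\mathcal{B}_{M^\ast}\}$. A matroid $N$ is identically self-dual if $N=N^\ast$ (i.e. $\mathcal{B}_N=\mathcal{B}_{N^\ast}$). -}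

module Defs where

open import Data.Nat using (ℕ)
open import Data.Bool using (Bool; true; false; T; _∧_; if_then_else_)
open import Data.Fin using (Fin)
open import Data.Fin.Subset using (Subset; _∈_; _∉_; ∁; _∪_; _─_; _-_; ⁅_⁆; ∣_∣)
open import Data.Vec using (Vec; lookup; foldr; tabulate)
open import Data.Product using (Σ; ∃; _×_; _,_)
open import Data.Rational using (ℚ; 0ℚ; 1ℚ; _+_; _*_; _<_)
open import Relation.Binary.PropositionalEquality using (_≡_; _≢_)
open import Relation.Nullary using (¬_)
open import Function.Bundles using (_⇔_)

record Matroid (n : ℕ) : Set where
  field
    isBase   : Subset n → Bool
    nonempty : ∃ λ B → T (isBase B)
    exchange : ∀ B₁ B₂ → T (isBase B₁) → T (isBase B₂) →
               ∀ x → x ∈ B₁ → x ∉ B₂ →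
               ∃ λ y → y ∈ B₂ × y ∉ B₁ × T (isBase ((B₁ - x) ∪ ⁅ y ⁆))
open Matroid public

isDualBase : ∀ {n} → Matroid n → Subset n → Bool
isDualBase M B = isBase M (∁ B)

isBaseCobase : ∀ {n} → Matroid n → Subset n → Bool
isBaseCobase M B = isBase M B ∧ isDualBase M B

IsBlockMatroid : ∀ {n} → Matroid n → Set
IsBlockMatroid M = ∃ λ B → T (isBaseCobase M B)

IdenticallySelfDual : ∀ {n} → Matroid n → Set
IdenticallySelfDual N = ∀ X → isBase N X ≡ isDualBase N X

Adjacent : ∀ {n} → Subset n → Subset n → Set
Adjacent X Y = ∣ X ─ Y ∣ Data.Nat.+ ∣ Y ─ X ∣ ≡ 2
  where import Data.Nat

incidence : ∀ {n} → Subset n → Vec ℚ n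
incidence B = Data.Vec.map (λ b → if b then 1ℚ else 0ℚ) B
  where import Data.Vec

dot : ∀ {n} → Vec ℚ n → Vec ℚ n → ℚ
dot c x = foldr _ _+_ 0ℚ (Data.Vec.zipWith _*_ c x)
  where import Data.Vec

-- {x_B, x_B'} is an edge (1-dimensional face) of P_{M,M*} = conv{x_Z : Z base-cobase}:
-- some linear functional c attains its maximum over P exactly on the segment
-- [x_B, x_B'], i.e. c·x_B = c·x_B' > c·x_Z for all other base-cobases Z.
IsPolytopeEdge : ∀ {n} → Matroid n → Subset n → Subset n → Set
IsPolytopeEdge {n} M B B' =
  ∃ λ (c : Vec ℚ n) →
    dot c (incidence B) ≡ dot c (incidence B') ×
    (∀ Z → T (isBaseCobase M Z) → Z ≢ B → Z ≢ B' →
       dot c (incidence Z) < dot c (incidence B))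

ConditionI : ∀ {n} → Matroid n → Set
ConditionI {n} M = ∃ λ (N : Matroid n) → ∀ X → isBase N X ≡ isBaseCobase M X

ConditionII : ∀ {n} → Matroid n → Set
ConditionII M = ∀ B B' → T (isBaseCobase M B) → T (isBaseCobase M B') → B ≢ B' →
  (Adjacent B B' ⇔ IsPolytopeEdge M B B')

ConditionIII : ∀ {n} → Matroid n → Set
ConditionIII {n} M = ∃ λ (N : Matroid n) →
  IdenticallySelfDual N ×
  (∀ X → T (isBase N X) → T (isBase M X)) ×
  (∀ X → isBaseCobase N X ≡ isBaseCobase M X)

-- (i) ⇔ (iii): the base-cobases of M are closed under complementation, so a matroid whose bases
-- are exactly the base-cobases is identically self-dual; conversely every base of an identically
-- self-dual N is a base-cobase of N.
--
-- (i) ⇒ (ii) is the fact that the base graph of a matroid is the 1-skeleton of its base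
-- polytope. Non-adjacent bases B, B′ span no edge: for any weight c, the exchange axiom at an
-- element of B Δ B′ of least weight yields a base Z ∉ {B, B′} with c·Z ≥ c·B.
--
-- The remaining implications rest on one construction. Let v, u be equicardinal members of a
-- family 𝓑 and x ∈ v ∖ u, where u minimises |u ∖ v| among the W ∈ 𝓑 with v ∩ u ⊆ W ⊆ v ∪ u and
-- x ∉ W. Then explicit weights, affine in m = |u ∖ v|, expose [x_v, x_u] as an edge of conv 𝓑.
-- Adjacent bases satisfy this trivially. For (ii) ⇒ (i), if x ∈ B₁ ∖ B₂ had no exchange inside
-- the base-cobases, such a u between B₁ and B₂ would be adjacent to B₁ by (ii), hence
-- u = B₁ − x + y with y ∈ B₂ ∖ B₁: an exchange after all.

module Submission where

open import Defs
open import Data.Nat using (ℕ; zero; suc; _+_; _*_; _≤_; _<_; _≤ᵇ_; z≤n; s≤s)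
import Data.Nat.Properties as ℕ
open import Data.Nat.Induction using (<-wellFounded)
open import Data.Nat.Tactic.RingSolver using (solve-∀)
open import Data.Bool using (Bool; true; false; _∧_; _∨_; not; T; if_then_else_) renaming (_≟_ to _≟𝔹_)
import Data.Bool.Properties as Bool
open import Data.Fin using (Fin; zero; suc; _≟_)
open import Data.Fin.Properties using (any?)
open import Data.Fin.Subset using (Subset; _∈_; _∉_; ∁; _∪_; _─_; _-_; ⁅_⁆; ∣_∣)
open import Data.Vec using (Vec; []; _∷_; lookup; tabulate)
import Data.Vec.Properties as Vec
open import Data.Vec.Relation.Binary.Pointwise.Extensional using (ext; Pointwise-≡⇒≡)
open import Data.Rational using (ℚ; 0ℚ; 1ℚ)
  renaming (_+_ to _+ℚ_; _*_ to _*ℚ_; _<_ to _<ℚ_; _≤_ to _≤ℚ_)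
import Data.Rational.Properties as ℚ
open import Data.Product using (∃; _×_; _,_; proj₁; proj₂)
open import Data.Sum using (inj₁; inj₂)
open import Data.Empty using (⊥; ⊥-elim)
open import Function using (_∘_; _on_)
open import Function.Bundles using (_⇔_; mk⇔; Equivalence)
open import Relation.Binary.PropositionalEquality
open import Relation.Binary.Bundles using (TotalPreorder)
import Relation.Binary.Construct.On as On
open import Relation.Nullary using (yes; no; does; ¬_; contradiction)
open import Relation.Nullary.Decidable using (dec-true; dec-false)
open import Induction.WellFounded using (Acc; acc)
open import Algebra.Properties.CommutativeSemigroup ℕ.+-commutativeSemigroup using (xy∙z≈xz∙y)
open import Algebra.Properties.Semiring.Sum ℕ.+-*-semiring
  using (sum; sum-cong-≗; ∑-distrib-+; *-distribˡ-sum; sum-replicate-zero)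
import Algebra.Properties.CommutativeMonoid.Sum ℚ.+-0-commutativeMonoid as ℚ-Sum

𝟙 : Bool → ℕ
𝟙 b = if b then 1 else 0

∧-true : ∀ a b → a ∧ b ≡ true → a ≡ true × b ≡ true
∧-true a b h = Bool.∧-conicalˡ a b h , Bool.∧-conicalʳ a b h

infixr 4 _→ᵇ_
_→ᵇ_ : Bool → Bool → Bool
a →ᵇ b = not a ∨ b

→ᵇ-intro : ∀ {a b} → (a ≡ true → b ≡ true) → T (a →ᵇ b)
→ᵇ-intro {false} _ = _
→ᵇ-intro {true}  h rewrite h refl = _

→ᵇ-elim : ∀ {a b} → T (a →ᵇ b) → T a → T b
→ᵇ-elim {true} b _ = b

Valid : ∀ k → (Vec Bool k → Bool) → Bool
Valid zero    f = f []
Valid (suc k) f = Valid k (λ bs → f (false ∷ bs)) ∧ Valid k (λ bs → f (true ∷ bs))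

-- In `valid f _` the hole is solved by evaluation: T (Valid k f) normalises to ⊤ when f is a tautology.
valid : ∀ {k} (f : Vec Bool k → Bool) → T (Valid k f) → ∀ bs → T (f bs)
valid f holds []           = holds
valid f holds (false ∷ bs) = valid _ (proj₁ (Equivalence.to Bool.T-∧ holds)) bs
valid f holds (true  ∷ bs) = valid _ (proj₂ (Equivalence.to Bool.T-∧ holds)) bs

_≡ᵇ_ : ∀ {n} → Fin n → Fin n → Bool
i ≡ᵇ j = does (i ≟ j)

≡ᵇ-refl : ∀ {n} (i : Fin n) → (i ≡ᵇ i) ≡ true
≡ᵇ-refl i = dec-true (i ≟ i) refl

≡⇒≡ᵇ : ∀ {n} {i j : Fin n} → i ≡ j → (i ≡ᵇ j) ≡ true
≡⇒≡ᵇ {i = i} refl = ≡ᵇ-refl i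

≡ᵇ⇒≡ : ∀ {n} {i j : Fin n} → (i ≡ᵇ j) ≡ true → i ≡ j
≡ᵇ⇒≡ {i = i} {j} h with i ≟ j
... | yes i≡j = i≡j

at-point : ∀ {n} (P : Fin n → Bool) {j} → P j ≡ true → ∀ i → T ((i ≡ᵇ j) →ᵇ P i)
at-point P Pj i = →ᵇ-intro (λ i≡j → subst (λ k → P k ≡ true) (sym (≡ᵇ⇒≡ i≡j)) Pj)

sum-mono-≤ : ∀ {n} {f g : Fin n → ℕ} → (∀ i → f i ≤ g i) → sum f ≤ sum g
sum-mono-≤ {zero}  le = z≤n
sum-mono-≤ {suc n} le = ℕ.+-mono-≤ (le zero) (sum-mono-≤ (λ i → le (suc i)))

sum-+-mono-≤ : ∀ {n} {f g h k : Fin n → ℕ} → (∀ i → f i + g i ≤ h i + k i) →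
  sum f + sum g ≤ sum h + sum k
sum-+-mono-≤ {f = f} {g} {h} {k} le =
  subst₂ _≤_ (∑-distrib-+ f g) (∑-distrib-+ h k) (sum-mono-≤ le)

sum-+-cong : ∀ {n} {f g h k : Fin n → ℕ} → (∀ i → f i + g i ≡ h i + k i) →
  sum f + sum g ≡ sum h + sum k
sum-+-cong {f = f} {g} {h} {k} eq =
  trans (sym (∑-distrib-+ f g)) (trans (sum-cong-≗ eq) (∑-distrib-+ h k))

sum-zero : ∀ {n} → sum {n} (λ _ → 0) ≡ 0
sum-zero {n} = sum-replicate-zero n

count : ∀ {n} → (Fin n → Bool) → ℕ
count p = sum (λ i → 𝟙 (p i))

sum-if : ∀ {n} k (p : Fin n → Bool) → sum (λ i → if p i then k else 0) ≡ k * count p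
sum-if k p = trans (sum-cong-≗ (λ i → k*𝟙 (p i))) (sym (*-distribˡ-sum k (λ i → 𝟙 (p i))))
  where
  k*𝟙 : ∀ b → (if b then k else 0) ≡ k * 𝟙 b
  k*𝟙 true  = sym (ℕ.*-identityʳ k)
  k*𝟙 false = sym (ℕ.*-zeroʳ k)

count-point : ∀ {n} (j : Fin n) → count (_≡ᵇ j) ≡ 1
count-point {suc n} zero    = cong suc (sum-zero {n})
count-point {suc n} (suc j) = count-point j

_⊆ᵇ_ : ∀ {n} → (Fin n → Bool) → (Fin n → Bool) → Set
p ⊆ᵇ q = ∀ i → p i ≡ true → q i ≡ true

count-⊂ : ∀ {n} {p q : Fin n → Bool} {j} → p ⊆ᵇ q → q j ≡ true → p j ≡ false →
  count p < count q
count-⊂ {n} {p} {q} {j} p⊆q qj pj =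
  subst₂ _≤_ (trans (cong (count p +_) (count-point j)) (ℕ.+-comm (count p) 1))
             (trans (cong (count q +_) (sum-zero {n})) (ℕ.+-identityʳ (count q)))
             (sum-+-mono-≤ pointwise)
  where
  pointwise : ∀ i → 𝟙 (p i) + 𝟙 (i ≡ᵇ j) ≤ 𝟙 (q i) + 0
  pointwise i with i ≟ j
  ... | yes refl rewrite pj | qj = ℕ.≤-refl
  ... | no _ with p i in pi
  ...   | false = z≤n
  ...   | true rewrite p⊆q i pi = ℕ.≤-refl

count>0⇒∃ : ∀ {n} {p : Fin n → Bool} → 0 < count p → ∃ λ i → p i ≡ true
count>0⇒∃ {n} {p} pos with any? (λ i → p i ≟𝔹 true)
... | yes found = found
... | no none = contradiction (subst (0 <_) (sum-cong-≗ (λ i → cong 𝟙 (false-everywhere i))) pos)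
                              (ℕ.<-irrefl (sym (sum-zero {n})))
  where
  false-everywhere : ∀ i → p i ≡ false
  false-everywhere i with p i in pi
  ... | false = refl
  ... | true  = ⊥-elim (none (i , pi))

true⇒count>0 : ∀ {n} {p : Fin n → Bool} {i} → p i ≡ true → 0 < count p
true⇒count>0 {n} {p} pi =
  subst (_< count p) (sum-zero {n}) (count-⊂ {p = λ _ → false} {q = p} (λ _ ()) pi refl)

count≡0⇒false : ∀ {n} {p : Fin n → Bool} → count p ≡ 0 → ∀ i → p i ≡ false
count≡0⇒false {p = p} empty i with p i in pi
... | false = refl
... | true  = contradiction empty (ℕ.<⇒≢ (true⇒count>0 {p = p} pi) ∘ sym)

count≤1⇒unique : ∀ {n} {p : Fin n → Bool} → count p ≤ 1 →
  ∀ {i j} → p i ≡ true → p j ≡ true → i ≡ j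
count≤1⇒unique {p = p} atMostOne {i} {j} pi pj with i ≟ j
... | yes i≡j = i≡j
... | no  i≢j = contradiction (subst (_< count p) (count-point i) two-points) (ℕ.≤⇒≯ atMostOne)
  where
  two-points : count (_≡ᵇ i) < count p
  two-points = count-⊂ {p = _≡ᵇ i} {q = p} (λ k k≡i → subst (λ k → p k ≡ true) (sym (≡ᵇ⇒≡ k≡i)) pi) pj
                       (dec-false (j ≟ i) (λ j≡i → i≢j (sym j≡i)))

⊆ᵇ-reverse : ∀ {n} {p q : Fin n → Bool} → p ⊆ᵇ q → count q ≤ count p → q ⊆ᵇ p
⊆ᵇ-reverse {p = p} p⊆q q≤p i qi with p i in pi
... | true  = refl
... | false = contradiction q≤p (ℕ.<⇒≱ (count-⊂ p⊆q qi pi))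

⊆ᵇ-antisym : ∀ {n} {p q : Fin n → Bool} → p ⊆ᵇ q → q ⊆ᵇ p → ∀ i → p i ≡ q i
⊆ᵇ-antisym {p = p} {q} p⊆q q⊆p i with p i in pi | q i in qi
... | true  | _     = trans (sym (p⊆q i pi)) qi
... | false | false = refl
... | false | true  = trans (sym pi) (q⊆p i qi)

lookup-∁ : ∀ {n} (p : Subset n) i → lookup (∁ p) i ≡ not (lookup p i)
lookup-∁ p i = Vec.lookup-map i not p

lookup-∪ : ∀ {n} (p q : Subset n) i → lookup (p ∪ q) i ≡ lookup p i ∨ lookup q i
lookup-∪ p q i = Vec.lookup-zipWith _∨_ i p q

lookup-─ : ∀ {n} (p q : Subset n) i → lookup (p ─ q) i ≡ lookup p i ∧ not (lookup q i)
lookup-─ (true  ∷ p) (true  ∷ q) zero    = refl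
lookup-─ (true  ∷ p) (false ∷ q) zero    = refl
lookup-─ (false ∷ p) (true  ∷ q) zero    = refl
lookup-─ (false ∷ p) (false ∷ q) zero    = refl
lookup-─ (_     ∷ p) (_     ∷ q) (suc i) = lookup-─ p q i

lookup-⁅⁆ : ∀ {n} (j i : Fin n) → lookup ⁅ j ⁆ i ≡ i ≡ᵇ j
lookup-⁅⁆ zero    zero    = refl
lookup-⁅⁆ zero    (suc i) = Vec.lookup-replicate i false
lookup-⁅⁆ (suc j) zero    = refl
lookup-⁅⁆ (suc j) (suc i) = lookup-⁅⁆ j i

lookup-ext : ∀ {n} {p q : Subset n} → (∀ i → lookup p i ≡ lookup q i) → p ≡ q
lookup-ext eq = Pointwise-≡⇒≡ (ext eq)

∈⇒lookup : ∀ {n} {x : Fin n} {p} → x ∈ p → lookup p x ≡ true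
∈⇒lookup = Vec.[]=⇒lookup

lookup⇒∈ : ∀ {n} {x : Fin n} {p} → lookup p x ≡ true → x ∈ p
lookup⇒∈ {x = x} {p} = Vec.lookup⇒[]= x p

∉⇒lookup : ∀ {n} {x : Fin n} {p} → x ∉ p → lookup p x ≡ false
∉⇒lookup {x = x} {p} x∉p with lookup p x in px
... | false = refl
... | true  = ⊥-elim (x∉p (lookup⇒∈ px))

lookup⇒∉ : ∀ {n} {x : Fin n} {p} → lookup p x ≡ false → x ∉ p
lookup⇒∉ px x∈p with trans (sym (∈⇒lookup x∈p)) px
... | ()

_∖_ : ∀ {n} → Subset n → Subset n → Fin n → Bool
(p ∖ q) i = lookup p i ∧ not (lookup q i)

∖-intro : ∀ {n} {p q : Subset n} {i} → lookup p i ≡ true → lookup q i ≡ false → (p ∖ q) i ≡ true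
∖-intro pi qi = cong₂ (λ a b → a ∧ not b) pi qi

∖-elim : ∀ {n} {p q : Subset n} {i} → (p ∖ q) i ≡ true → lookup p i ≡ true × lookup q i ≡ false
∖-elim {p = p} {q} {i} h with ∧-true (lookup p i) (not (lookup q i)) h
... | pi , ¬qi = pi , Bool.not-injective ¬qi

∣∣≡count : ∀ {n} (p : Subset n) → ∣ p ∣ ≡ count (lookup p)
∣∣≡count []          = refl
∣∣≡count (true  ∷ p) = cong suc (∣∣≡count p)
∣∣≡count (false ∷ p) = ∣∣≡count p

∣─∣≡count : ∀ {n} (p q : Subset n) → ∣ p ─ q ∣ ≡ count (p ∖ q)
∣─∣≡count p q = trans (∣∣≡count (p ─ q)) (sum-cong-≗ (λ i → cong 𝟙 (lookup-─ p q i)))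

count-∖-sym : ∀ {n} (p q : Subset n) → count (lookup p) ≡ count (lookup q) → count (p ∖ q) ≡ count (q ∖ p)
count-∖-sym p q ∣p∣≡∣q∣ = ℕ.+-cancelˡ-≡ (count (lookup q)) _ _
  (trans (sum-+-cong (λ i → split (lookup p i) (lookup q i))) (cong (_+ count (q ∖ p)) ∣p∣≡∣q∣))
  where
  split : ∀ a b → 𝟙 b + 𝟙 (a ∧ not b) ≡ 𝟙 a + 𝟙 (b ∧ not a)
  split true  true  = refl
  split true  false = refl
  split false true  = refl
  split false false = refl

∖-empty⇒⊆ : ∀ {n} {p q : Subset n} → count (p ∖ q) ≡ 0 → lookup p ⊆ᵇ lookup q
∖-empty⇒⊆ {p = p} {q} empty i pi with lookup q i in qi
... | true  = refl
... | false = ⊥-elim (Bool.not-¬ (∖-intro {p = p} {q = q} pi qi) (count≡0⇒false empty i))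

⊆-equicardinal⇒≡ : ∀ {n} (p q : Subset n) → lookup p ⊆ᵇ lookup q → count (lookup q) ≤ count (lookup p) →
  p ≡ q
⊆-equicardinal⇒≡ p q p⊆q ∣q∣≤∣p∣ = lookup-ext (⊆ᵇ-antisym p⊆q (⊆ᵇ-reverse p⊆q ∣q∣≤∣p∣))

symmetric-difference-nonempty : ∀ {n} {B B′ : Subset n} → B ≢ B′ → ∃ λ i → ((B ∖ B′) i ∨ (B′ ∖ B) i) ≡ true
symmetric-difference-nonempty {B = B} {B′} B≢B′ with any? (λ i → ((B ∖ B′) i ∨ (B′ ∖ B) i) ≟𝔹 true)
... | yes found = found
... | no none = ⊥-elim (B≢B′ (lookup-ext same))
  where
  same : ∀ i → lookup B i ≡ lookup B′ i
  same i with lookup B i | lookup B′ i | none ∘ (i ,_)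
  ... | true  | true  | _ = refl
  ... | false | false | _ = refl
  ... | true  | false | ¬Δ = ⊥-elim (¬Δ refl)
  ... | false | true  | ¬Δ = ⊥-elim (¬Δ refl)

adjacent-sym : ∀ {n} {B B′ : Subset n} → Adjacent B B′ → Adjacent B′ B
adjacent-sym {B = B} {B′} adj = trans (ℕ.+-comm ∣ B′ ─ B ∣ ∣ B ─ B′ ∣) adj

adjacent⇒counts : ∀ {n} (B B′ : Subset n) → count (lookup B) ≡ count (lookup B′) → Adjacent B B′ →
  count (B ∖ B′) ≡ 1 × count (B′ ∖ B) ≡ 1
adjacent⇒counts B B′ ∣B∣≡∣B′∣ adj = half _ both , trans (sym sym-diff) (half _ both)
  where
  sym-diff : count (B ∖ B′) ≡ count (B′ ∖ B)
  sym-diff = count-∖-sym B B′ ∣B∣≡∣B′∣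
  both : count (B ∖ B′) + count (B ∖ B′) ≡ 2
  both = trans (cong (count (B ∖ B′) +_) sym-diff)
               (trans (sym (cong₂ _+_ (∣─∣≡count B B′) (∣─∣≡count B′ B))) adj)
  half : ∀ k → k + k ≡ 2 → k ≡ 1
  half 0 ()
  half 1 _ = refl
  half (suc (suc k)) eq with ℕ.m+n≡0⇒n≡0 k (ℕ.suc-injective (ℕ.suc-injective eq))
  ... | ()

replace : ∀ {n} → Subset n → Fin n → Fin n → Subset n
replace B x y = (B - x) ∪ ⁅ y ⁆

lookup-replace : ∀ {n} (B : Subset n) x y i →
  lookup (replace B x y) i ≡ (lookup B i ∧ not (i ≡ᵇ x)) ∨ (i ≡ᵇ y)
lookup-replace B x y i = trans (lookup-∪ (B - x) ⁅ y ⁆ i)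
  (cong₂ _∨_ (trans (lookup-─ B ⁅ x ⁆ i) (cong (λ b → lookup B i ∧ not b) (lookup-⁅⁆ x i)))
             (lookup-⁅⁆ y i))

module Replace {n} (B : Subset n) {x y : Fin n} (Bx : lookup B x ≡ true) (By : lookup B y ≡ false) where

  private
    is-x : ∀ i → T ((i ≡ᵇ x) →ᵇ lookup B i)
    is-x = at-point (lookup B) Bx

    is-y : ∀ i → T ((i ≡ᵇ y) →ᵇ not (lookup B i))
    is-y = at-point (λ i → not (lookup B i)) (cong not By)

  count-replace : count (lookup (replace B x y)) ≡ count (lookup B)
  count-replace = ℕ.+-cancelʳ-≡ 1 _ _ (begin
    count (lookup (replace B x y)) + 1               ≡⟨ cong (count (lookup (replace B x y)) +_) (count-point x) ⟨
    count (lookup (replace B x y)) + count (_≡ᵇ x)   ≡⟨ sum-+-cong pointwise ⟩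
    count (lookup B) + count (_≡ᵇ y)                 ≡⟨ cong (count (lookup B) +_) (count-point y) ⟩
    count (lookup B) + 1                             ∎)
    where
    open ≡-Reasoning
    swap : ∀ b ex ey → T (ex →ᵇ b) → T (ey →ᵇ not b) → 𝟙 ((b ∧ not ex) ∨ ey) + 𝟙 ex ≡ 𝟙 b + 𝟙 ey
    swap true  false false _ _ = refl
    swap true  true  false _ _ = refl
    swap false false false _ _ = refl
    swap false false true  _ _ = refl
    pointwise : ∀ i → 𝟙 (lookup (replace B x y) i) + 𝟙 (i ≡ᵇ x) ≡ 𝟙 (lookup B i) + 𝟙 (i ≡ᵇ y)
    pointwise i rewrite lookup-replace B x y i = swap (lookup B i) (i ≡ᵇ x) (i ≡ᵇ y) (is-x i) (is-y i)

  count-replace-∖ : ∀ C → lookup C x ≡ false → lookup C y ≡ true →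
    count (replace B x y ∖ C) + 1 ≡ count (B ∖ C)
  count-replace-∖ C Cx Cy = begin
    count (replace B x y ∖ C) + 1              ≡⟨ cong (count (replace B x y ∖ C) +_) (count-point x) ⟨
    count (replace B x y ∖ C) + count (_≡ᵇ x)  ≡⟨ sum-+-cong pointwise ⟩
    count (B ∖ C) + sum {n} (λ _ → 0)          ≡⟨ cong (count (B ∖ C) +_) (sum-zero {n}) ⟩
    count (B ∖ C) + 0                          ≡⟨ ℕ.+-identityʳ (count (B ∖ C)) ⟩
    count (B ∖ C)                              ∎
    where
    open ≡-Reasoning
    swap : ∀ b c ex ey → T (ex →ᵇ (b ∧ not c)) → T (ey →ᵇ (c ∧ not b)) →
      𝟙 (((b ∧ not ex) ∨ ey) ∧ not c) + 𝟙 ex ≡ 𝟙 (b ∧ not c) + 0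
    swap true  true  false false _ _ = refl
    swap true  false false false _ _ = refl
    swap false true  false false _ _ = refl
    swap false false false false _ _ = refl
    swap true  false true  false _ _ = refl
    swap false true  false true  _ _ = refl
    pointwise : ∀ i → 𝟙 ((replace B x y ∖ C) i) + 𝟙 (i ≡ᵇ x) ≡ 𝟙 ((B ∖ C) i) + 0
    pointwise i rewrite lookup-replace B x y i =
      swap (lookup B i) (lookup C i) (i ≡ᵇ x) (i ≡ᵇ y)
           (at-point (B ∖ C) (cong₂ (λ b c → b ∧ not c) Bx Cx) i)
           (at-point (C ∖ B) (cong₂ (λ c b → c ∧ not b) Cy By) i)

  replace-adjacent : Adjacent B (replace B x y)
  replace-adjacent = begin
    ∣ B ─ replace B x y ∣ + ∣ replace B x y ─ B ∣
      ≡⟨ cong₂ _+_ (∣─∣≡count B (replace B x y)) (∣─∣≡count (replace B x y) B) ⟩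
    count (B ∖ replace B x y) + count (replace B x y ∖ B)
      ≡⟨ cong₂ _+_ (trans (sum-cong-≗ removed) (count-point x))
                   (trans (sum-cong-≗ added) (count-point y)) ⟩
    2 ∎
    where
    open ≡-Reasoning
    removed′ : ∀ b ex ey → T (ex →ᵇ b) → T (ey →ᵇ not b) → 𝟙 (b ∧ not ((b ∧ not ex) ∨ ey)) ≡ 𝟙 ex
    removed′ true  false false _ _ = refl
    removed′ true  true  false _ _ = refl
    removed′ false false false _ _ = refl
    removed′ false false true  _ _ = refl
    added′ : ∀ b ex ey → T (ex →ᵇ b) → T (ey →ᵇ not b) → 𝟙 (((b ∧ not ex) ∨ ey) ∧ not b) ≡ 𝟙 ey
    added′ true  false false _ _ = refl
    added′ true  true  false _ _ = refl
    added′ false false false _ _ = refl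
    added′ false false true  _ _ = refl
    removed : ∀ i → 𝟙 ((B ∖ replace B x y) i) ≡ 𝟙 (i ≡ᵇ x)
    removed i rewrite lookup-replace B x y i = removed′ (lookup B i) (i ≡ᵇ x) (i ≡ᵇ y) (is-x i) (is-y i)
    added : ∀ i → 𝟙 ((replace B x y ∖ B) i) ≡ 𝟙 (i ≡ᵇ y)
    added i rewrite lookup-replace B x y i = added′ (lookup B i) (i ≡ᵇ x) (i ≡ᵇ y) (is-x i) (is-y i)

  replace-∌ : lookup (replace B x y) x ≡ false
  replace-∌ rewrite lookup-replace B x y x | ≡ᵇ-refl x | Bool.∧-zeroʳ (lookup B x)
    with x ≟ y
  ... | yes refl = contradiction (trans (sym Bx) By) λ ()
  ... | no _     = refl

adjacent⇒replace : ∀ {n} (B u : Subset n) → count (lookup B) ≡ count (lookup u) → Adjacent B u →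
  ∀ {x} → lookup B x ≡ true → lookup u x ≡ false →
  ∃ λ y → lookup u y ≡ true × lookup B y ≡ false × u ≡ replace B x y
adjacent⇒replace B u ∣B∣≡∣u∣ adj {x} Bx ux
  with adjacent⇒counts B u ∣B∣≡∣u∣ adj
... | one-out , one-in with count>0⇒∃ {p = u ∖ B} (subst (0 <_) (sym one-in) (s≤s z≤n))
... | y , u∖By = y , uy , By , lookup-ext λ i → trans (determined i) (sym (lookup-replace B x y i))
  where
  uy : lookup u y ≡ true
  uy = proj₁ (∖-elim {p = u} {q = B} u∖By)
  By : lookup B y ≡ false
  By = proj₂ (∖-elim {p = u} {q = B} u∖By)
  only-x : ∀ i → T ((B ∖ u) i →ᵇ (i ≡ᵇ x))
  only-x i = →ᵇ-intro λ h →
    ≡⇒≡ᵇ (count≤1⇒unique {p = B ∖ u} (ℕ.≤-reflexive one-out) {i} h (∖-intro {p = B} {q = u} Bx ux))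
  only-y : ∀ i → T ((u ∖ B) i →ᵇ (i ≡ᵇ y))
  only-y i = →ᵇ-intro λ h → ≡⇒≡ᵇ (count≤1⇒unique {p = u ∖ B} (ℕ.≤-reflexive one-in) {i} h u∖By)
  solve : ∀ b c ex ey → T (ex →ᵇ (b ∧ not c)) → T (ey →ᵇ (c ∧ not b)) →
    T ((b ∧ not c) →ᵇ ex) → T ((c ∧ not b) →ᵇ ey) → c ≡ (b ∧ not ex) ∨ ey
  solve true  true  false false _ _ _ _ = refl
  solve false false false false _ _ _ _ = refl
  solve true  false true  false _ _ _ _ = refl
  solve false true  false true  _ _ _ _ = refl
  determined : ∀ i → lookup u i ≡ (lookup B i ∧ not (i ≡ᵇ x)) ∨ (i ≡ᵇ y)
  determined i = solve (lookup B i) (lookup u i) (i ≡ᵇ x) (i ≡ᵇ y)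
    (at-point (B ∖ u) (∖-intro {p = B} {q = u} Bx ux) i) (at-point (u ∖ B) u∖By i) (only-x i) (only-y i)

IsBase : ∀ {n} → Matroid n → Subset n → Set
IsBase M X = T (isBase M X)

exchange′ : ∀ {n} (M : Matroid n) {B₁ B₂} → IsBase M B₁ → IsBase M B₂ →
  ∀ {x} → lookup B₁ x ≡ true → lookup B₂ x ≡ false →
  ∃ λ y → lookup B₂ y ≡ true × lookup B₁ y ≡ false × IsBase M (replace B₁ x y)
exchange′ M {B₁} {B₂} b₁ b₂ {x} B₁x B₂x
  with exchange M B₁ B₂ b₁ b₂ x (lookup⇒∈ B₁x) (lookup⇒∉ B₂x)
... | y , y∈B₂ , y∉B₁ , b = y , ∈⇒lookup y∈B₂ , ∉⇒lookup y∉B₁ , b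

bases-equicardinal : ∀ {n} (M : Matroid n) {B₁ B₂} → IsBase M B₁ → IsBase M B₂ →
  count (lookup B₁) ≡ count (lookup B₂)
bases-equicardinal M {B₁} {B₂} b₁ b₂ = go (count (B₁ ∖ B₂)) b₁ b₂ refl
  where
  go : ∀ k {B₁} → IsBase M B₁ → IsBase M B₂ → count (B₁ ∖ B₂) ≡ k →
    count (lookup B₁) ≡ count (lookup B₂)
  go zero {B₁} b₁ b₂ empty = sum-cong-≗ (λ i → cong 𝟙 (same i))
    where
    same : ∀ i → lookup B₁ i ≡ lookup B₂ i
    same i with lookup B₁ i in B₁i | lookup B₂ i in B₂i
    ... | false | false = refl
    ... | true  | true  = refl
    ... | true  | false = ⊥-elim (Bool.not-¬ (∖-intro {p = B₁} {q = B₂} B₁i B₂i) (count≡0⇒false empty i))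
    ... | false | true with exchange′ M b₂ b₁ B₂i B₁i
    ...   | y , B₁y , B₂y , _ =
      ⊥-elim (Bool.not-¬ (∖-intro {p = B₁} {q = B₂} B₁y B₂y) (count≡0⇒false empty y))
  go (suc k) {B₁} b₁ b₂ diff with count>0⇒∃ {p = B₁ ∖ B₂} (subst (0 <_) (sym diff) (s≤s z≤n))
  ... | x , B₁∖B₂x with ∖-elim {p = B₁} {q = B₂} B₁∖B₂x
  ... | B₁x , B₂x with exchange′ M b₁ b₂ B₁x B₂x
  ... | y , B₂y , B₁y , b₃ = trans (sym count-replace) (go k b₃ b₂ smaller)
    where
    open Replace B₁ B₁x B₁y
    smaller : count (replace B₁ x y ∖ B₂) ≡ k
    smaller = ℕ.suc-injective (trans (ℕ.+-comm 1 _) (trans (count-replace-∖ B₂ B₂x B₂y) diff))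

-- Linear functionals and edges

χ : Bool → ℚ
χ b = if b then 1ℚ else 0ℚ

dot-sum : ∀ {n} (c : Vec ℚ n) (W : Subset n) →
  dot c (incidence W) ≡ ℚ-Sum.sum (λ i → lookup c i *ℚ χ (lookup W i))
dot-sum []      []      = refl
dot-sum (a ∷ c) (b ∷ W) = cong (a *ℚ χ b +ℚ_) (dot-sum c W)

ℚ-sum-point : ∀ {n} (h : Fin n → ℚ) j → ℚ-Sum.sum (λ i → if i ≡ᵇ j then h i else 0ℚ) ≡ h j
ℚ-sum-point {suc n} h zero    =
  trans (cong (h zero +ℚ_) (ℚ-Sum.sum-replicate-zero n)) (ℚ.+-identityʳ (h zero))
ℚ-sum-point {suc n} h (suc j) = trans (ℚ.+-identityˡ _) (ℚ-sum-point (λ i → h (suc i)) j)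

dot-replace : ∀ {n} (c : Vec ℚ n) (B : Subset n) {x y} → lookup B x ≡ true → lookup B y ≡ false →
  dot c (incidence (replace B x y)) +ℚ lookup c x ≡ dot c (incidence B) +ℚ lookup c y
dot-replace c B {x} {y} Bx By = begin
  dot c (incidence (replace B x y)) +ℚ lookup c x
    ≡⟨ cong₂ _+ℚ_ (dot-sum c (replace B x y)) (sym (ℚ-sum-point (lookup c) x)) ⟩
  ℚ-Sum.sum (term (replace B x y)) +ℚ ℚ-Sum.sum (λ i → if i ≡ᵇ x then lookup c i else 0ℚ)
    ≡⟨ ℚ-Sum.∑-distrib-+ (term (replace B x y)) _ ⟨
  ℚ-Sum.sum (λ i → term (replace B x y) i +ℚ (if i ≡ᵇ x then lookup c i else 0ℚ))
    ≡⟨ ℚ-Sum.sum-cong-≗ pointwise ⟩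
  ℚ-Sum.sum (λ i → term B i +ℚ (if i ≡ᵇ y then lookup c i else 0ℚ))
    ≡⟨ ℚ-Sum.∑-distrib-+ (term B) _ ⟩
  ℚ-Sum.sum (term B) +ℚ ℚ-Sum.sum (λ i → if i ≡ᵇ y then lookup c i else 0ℚ)
    ≡⟨ cong₂ _+ℚ_ (sym (dot-sum c B)) (ℚ-sum-point (lookup c) y) ⟩
  dot c (incidence B) +ℚ lookup c y ∎
  where
  open ≡-Reasoning
  term : Subset _ → Fin _ → ℚ
  term W i = lookup c i *ℚ χ (lookup W i)
  swap : ∀ a b ex ey → T (ex →ᵇ b) → T (ey →ᵇ not b) →
    a *ℚ χ ((b ∧ not ex) ∨ ey) +ℚ (if ex then a else 0ℚ) ≡ a *ℚ χ b +ℚ (if ey then a else 0ℚ)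
  swap a true  false false _ _ = refl
  swap a false false false _ _ = refl
  swap a true  true  false _ _ = begin
    a *ℚ 0ℚ +ℚ a  ≡⟨ cong (_+ℚ a) (ℚ.*-zeroʳ a) ⟩
    0ℚ +ℚ a       ≡⟨ ℚ.+-comm 0ℚ a ⟩
    a +ℚ 0ℚ       ≡⟨ cong (_+ℚ 0ℚ) (ℚ.*-identityʳ a) ⟨
    a *ℚ 1ℚ +ℚ 0ℚ ∎
  swap a false false true  _ _ = begin
    a *ℚ 1ℚ +ℚ 0ℚ ≡⟨ cong (_+ℚ 0ℚ) (ℚ.*-identityʳ a) ⟩
    a +ℚ 0ℚ       ≡⟨ ℚ.+-comm a 0ℚ ⟩
    0ℚ +ℚ a       ≡⟨ cong (_+ℚ a) (ℚ.*-zeroʳ a) ⟨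
    a *ℚ 0ℚ +ℚ a  ∎
  pointwise : ∀ i → term (replace B x y) i +ℚ (if i ≡ᵇ x then lookup c i else 0ℚ)
                  ≡ term B i +ℚ (if i ≡ᵇ y then lookup c i else 0ℚ)
  pointwise i rewrite lookup-replace B x y i =
    swap (lookup c i) (lookup B i) (i ≡ᵇ x) (i ≡ᵇ y)
         (at-point (lookup B) Bx i) (at-point (λ i → not (lookup B i)) (cong not By) i)

fromℕ : ℕ → ℚ
fromℕ zero    = 0ℚ
fromℕ (suc k) = 1ℚ +ℚ fromℕ k

fromℕ-+ : ∀ a b → fromℕ (a + b) ≡ fromℕ a +ℚ fromℕ b
fromℕ-+ zero    b = sym (ℚ.+-identityˡ (fromℕ b))
fromℕ-+ (suc a) b = trans (cong (1ℚ +ℚ_) (fromℕ-+ a b)) (sym (ℚ.+-assoc 1ℚ (fromℕ a) (fromℕ b)))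

fromℕ-mono-< : ∀ {a b} → a < b → fromℕ a <ℚ fromℕ b
fromℕ-mono-< {zero}  {suc b} _ = subst (_<ℚ 1ℚ +ℚ fromℕ b) (ℚ.+-identityˡ 0ℚ)
  (ℚ.+-mono-<-≤ (ℚ.positive⁻¹ 1ℚ) (nonNegative b))
  where
  nonNegative : ∀ k → 0ℚ ≤ℚ fromℕ k
  nonNegative zero    = ℚ.≤-refl
  nonNegative (suc k) = subst (_≤ℚ 1ℚ +ℚ fromℕ k) (ℚ.+-identityˡ 0ℚ)
    (ℚ.+-mono-≤ (ℚ.<⇒≤ (ℚ.positive⁻¹ 1ℚ)) (nonNegative k))
fromℕ-mono-< {suc a} {suc b} (s≤s a<b) = ℚ.+-monoʳ-< 1ℚ (fromℕ-mono-< a<b)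

dot-fromℕ : ∀ {n} (g : Fin n → ℕ) (W : Subset n) →
  dot (tabulate (λ i → fromℕ (g i))) (incidence W) ≡ fromℕ (sum λ i → if lookup W i then g i else 0)
dot-fromℕ {zero}  g []      = refl
dot-fromℕ {suc n} g (b ∷ W) =
  trans (cong₂ _+ℚ_ (head b) (dot-fromℕ (λ i → g (suc i)) W)) (sym (fromℕ-+ (if b then g zero else 0) _))
  where
  head : ∀ b → fromℕ (g zero) *ℚ χ b ≡ fromℕ (if b then g zero else 0)
  head true  = ℚ.*-identityʳ (fromℕ (g zero))
  head false = ℚ.*-zeroʳ (fromℕ (g zero))

module _ {c ℓ₁ ℓ₂} (O : TotalPreorder c ℓ₁ ℓ₂) where
  open TotalPreorder O using (_≲_; total) renaming (Carrier to A; refl to ≲-refl; trans to ≲-trans)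

  argmin : ∀ {n} (p : Fin n → Bool) (f : Fin n → A) → ∃ (λ i → p i ≡ true) →
    ∃ λ i → p i ≡ true × (∀ j → p j ≡ true → f i ≲ f j)
  argmin {suc n} p f (i , pi) with any? (λ j → p (suc j) ≟𝔹 true)
  argmin {suc n} p f (zero , p0) | no none =
    zero , p0 , λ { zero _ → ≲-refl ; (suc j) pj → ⊥-elim (none (j , pj)) }
  argmin {suc n} p f (suc i , pi) | no none = ⊥-elim (none (i , pi))
  argmin {suc n} p f _ | yes found with argmin (λ j → p (suc j)) (λ j → f (suc j)) found | p zero in p0
  ... | k , pk , min | false =
    suc k , pk , λ { zero pz → ⊥-elim (Bool.not-¬ pz p0) ; (suc j) pj → min j pj }
  ... | k , pk , min | true with total (f zero) (f (suc k))
  ...   | inj₁ f0≲ = zero , p0 , λ { zero _ → ≲-refl ; (suc j) pj → ≲-trans f0≲ (min j pj) }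
  ...   | inj₂ ≳f0 = suc k , pk , λ { zero _ → ≳f0 ; (suc j) pj → min j pj }

-- [x_B, x_B′] is an edge of conv {x_Z : T (𝓑 Z)}; IsPolytopeEdge M is IsEdge (isBaseCobase M).
IsEdge : ∀ {n} → (Subset n → Bool) → Subset n → Subset n → Set
IsEdge {n} 𝓑 B B′ =
  ∃ λ (c : Vec ℚ n) →
    dot c (incidence B) ≡ dot c (incidence B′) ×
    (∀ Z → T (𝓑 Z) → Z ≢ B → Z ≢ B′ → dot c (incidence Z) <ℚ dot c (incidence B))

IsEdge-cong : ∀ {n} {𝓑 𝓒 : Subset n → Bool} {B B′} → (∀ X → 𝓑 X ≡ 𝓒 X) → IsEdge 𝓑 B B′ → IsEdge 𝓒 B B′
IsEdge-cong 𝓑≡𝓒 (c , tie , below) = c , tie , λ Z 𝓒Z → below Z (subst T (sym (𝓑≡𝓒 Z)) 𝓒Z)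

record Affine : Set where
  constructor _·m+_
  field
    slope offset : ℕ

_⟨_⟩ : Affine → ℕ → ℕ
(a ·m+ b) ⟨ m ⟩ = a * m + b

infixl 6 _⊕_
_⊕_ : Affine → Affine → Affine
(a ·m+ b) ⊕ (c ·m+ d) = (a + c) ·m+ (b + d)

infixl 7 _⊛_
_⊛_ : Affine → Bool → Affine
p ⊛ b = if b then p else 0 ·m+ 0

⊕-⟨⟩ : ∀ p q m → (p ⊕ q) ⟨ m ⟩ ≡ p ⟨ m ⟩ + q ⟨ m ⟩
⊕-⟨⟩ (a ·m+ b) (c ·m+ d) m = distrib a b c d m
  where
  distrib : ∀ a b c d m → (a + c) * m + (b + d) ≡ a * m + b + (c * m + d)
  distrib = solve-∀

⊛-⟨⟩ : ∀ p b m → (p ⊛ b) ⟨ m ⟩ ≡ (if b then p ⟨ m ⟩ else 0)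
⊛-⟨⟩ p true  m = refl
⊛-⟨⟩ p false m = refl

sum-⊛ : ∀ {n} p (q : Fin n → Bool) m → sum (λ i → (p ⊛ q i) ⟨ m ⟩) ≡ p ⟨ m ⟩ * count q
sum-⊛ p q m = trans (sum-cong-≗ (λ i → ⊛-⟨⟩ p (q i) m)) (sum-if (p ⟨ m ⟩) q)

sum-⊛-point : ∀ {n} p (j : Fin n) m → sum (λ i → (p ⊛ (i ≡ᵇ j)) ⟨ m ⟩) ≡ p ⟨ m ⟩
sum-⊛-point p j m = trans (sum-⊛ p (_≡ᵇ j) m) (trans (cong (p ⟨ m ⟩ *_) (count-point j)) (ℕ.*-identityʳ _))

-- An affine inequality holds for every m ∈ ℕ iff it holds coefficientwise, so it can be decided.
_≤ᵃ_ : Affine → Affine → Bool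
(a ·m+ b) ≤ᵃ (c ·m+ d) = (a ≤ᵇ c) ∧ (b ≤ᵇ d)

≤ᵃ-sound : ∀ p q → T (p ≤ᵃ q) → ∀ m → p ⟨ m ⟩ ≤ q ⟨ m ⟩
≤ᵃ-sound (a ·m+ b) (c ·m+ d) le m with Equivalence.to Bool.T-∧ le
... | a≤c , b≤d = ℕ.+-mono-≤ (ℕ.*-monoˡ-≤ m (ℕ.≤ᵇ⇒≤ a c a≤c)) (ℕ.≤ᵇ⇒≤ b d b≤d)

shift : Affine
shift = 1 ·m+ 1

row : Affine → Bool → Bool → Affine → Affine
row w a b e = w ⊛ a ⊕ shift ⊛ b ⊕ e

sum-row : ∀ {n} m (w e : Fin n → Affine) (a b : Fin n → Bool) →
  sum (λ i → row (w i) (a i) (b i) (e i) ⟨ m ⟩)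
    ≡ sum (λ i → (w i ⊛ a i) ⟨ m ⟩) + shift ⟨ m ⟩ * count b + sum (λ i → e i ⟨ m ⟩)
sum-row m w e a b = begin
  sum (λ i → row (w i) (a i) (b i) (e i) ⟨ m ⟩)
    ≡⟨ sum-cong-≗ (λ i → trans (⊕-⟨⟩ (w i ⊛ a i ⊕ shift ⊛ b i) (e i) m)
                               (cong (_+ e i ⟨ m ⟩) (⊕-⟨⟩ (w i ⊛ a i) (shift ⊛ b i) m))) ⟩
  sum (λ i → W i + S i + E i)
    ≡⟨ ∑-distrib-+ (λ i → W i + S i) E ⟩
  sum (λ i → W i + S i) + sum E
    ≡⟨ cong (_+ sum E) (∑-distrib-+ W S) ⟩
  sum W + sum S + sum E
    ≡⟨ cong (λ s → sum W + s + sum E) (sum-⊛ shift b m) ⟩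
  sum W + shift ⟨ m ⟩ * count b + sum E ∎
  where
  open ≡-Reasoning
  W S E : Fin _ → ℕ
  W i = (w i ⊛ a i) ⟨ m ⟩
  S i = (shift ⊛ b i) ⟨ m ⟩
  E i = e i ⟨ m ⟩

RowwiseBelow : ∀ {n} (w e e′ : Fin n → Affine) (X Y : Fin n → Bool) → Set
RowwiseBelow w e e′ X Y = ∀ i → T (row (w i) (X i) (Y i) (e i) ≤ᵃ row (w i) (Y i) (X i) (e′ i))

-- Adding (m+1)·|Y| to the left and (m+1)·|X| to the right, i.e. the same amount, lets every weight
-- w i be compared as the possibly negative w i − (m+1) without leaving ℕ.
compare-rows : ∀ {n} m (w e e′ : Fin n → Affine) (X Y : Fin n → Bool) → count X ≡ count Y →
  RowwiseBelow w e e′ X Y →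
  sum (λ i → (w i ⊛ X i) ⟨ m ⟩) + sum (λ i → e i ⟨ m ⟩)
    ≤ sum (λ i → (w i ⊛ Y i) ⟨ m ⟩) + sum (λ i → e′ i ⟨ m ⟩)
compare-rows m w e e′ X Y ∣X∣≡∣Y∣ rows = ℕ.+-cancelʳ-≤ (K * count X) _ _ (begin
  wX + E + K * count X   ≡⟨ xy∙z≈xz∙y wX E _ ⟩
  wX + K * count X + E   ≡⟨ cong (λ k → wX + K * k + E) ∣X∣≡∣Y∣ ⟩
  wX + K * count Y + E   ≡⟨ sum-row m w e X Y ⟨
  sum (λ i → row (w i) (X i) (Y i) (e i) ⟨ m ⟩)
    ≤⟨ sum-mono-≤ (λ i → ≤ᵃ-sound (row (w i) (X i) (Y i) (e i)) (row (w i) (Y i) (X i) (e′ i)) (rows i) m) ⟩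
  sum (λ i → row (w i) (Y i) (X i) (e′ i) ⟨ m ⟩)
    ≡⟨ sum-row m w e′ Y X ⟩
  wY + K * count X + E′  ≡⟨ xy∙z≈xz∙y wY _ E′ ⟩
  wY + E′ + K * count X  ∎)
  where
  open ℕ.≤-Reasoning
  K wX wY E E′ : ℕ
  K = shift ⟨ m ⟩
  wX = sum (λ i → (w i ⊛ X i) ⟨ m ⟩)
  wY = sum (λ i → (w i ⊛ Y i) ⟨ m ⟩)
  E = sum (λ i → e i ⟨ m ⟩)
  E′ = sum (λ i → e′ i ⟨ m ⟩)

+suc≤+⇒< : ∀ a b k → a + suc k ≤ b + k → a < b
+suc≤+⇒< a b k le = ℕ.+-cancelʳ-≤ k (suc a) b (subst (_≤ b + k) (ℕ.+-suc a k) le)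

-- Edges from minimal sets between two members of a family

between : Bool → Bool → Bool → Bool
between a b w = (a ∧ b →ᵇ w) ∧ (w →ᵇ a ∨ b)

Between : ∀ {n} → Subset n → Subset n → Subset n → Set
Between v u W = ∀ i → T (between (lookup v i) (lookup u i) (lookup W i))

between-refl : ∀ a b → T (between a b b)
between-refl true  true  = _
between-refl true  false = _
between-refl false true  = _
between-refl false false = _

between-trans : ∀ a b c d → T (between a b c) → T (between a c d) → T (between a b d)
between-trans a b c d = →ᵇ-elim ∘ →ᵇ-elim (valid transitive _ (a ∷ b ∷ c ∷ d ∷ []))
  where
  transitive : Vec Bool 4 → Bool
  transitive (a ∷ b ∷ c ∷ d ∷ []) = between a b c →ᵇ between a c d →ᵇ between a b d

between-∖ : ∀ a b w → T (between a b w) → (w ∧ not a) ≡ true → (b ∧ not a) ≡ true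
between-∖ false true  true  _ _  = refl
between-∖ false false true  () _
between-∖ true  _     true  _ ()
between-∖ _     _     false _ ()

between-⊇ : ∀ a b w → T (between a b w) → ((b ∧ not a) ≡ true → (w ∧ not a) ≡ true) → b ≡ true → w ≡ true
between-⊇ true  true  true  _ _ _ = refl
between-⊇ false true  w     _ h _ = Bool.∧-conicalˡ w true (h refl)
between-⊇ _     false _     _ _ ()

-- With m = |u ∖ v|, shifting these weights by −(m+1) gives m+1 on v ∩ u, 1 on v ∖ u ∖ {x},
-- 1 − m at x, 0 on u ∖ v and −(m+1) off v ∪ u.
weight : Bool → Bool → Bool → Affine
weight _     _     true  = 0 ·m+ 2
weight true  true  false = 2 ·m+ 2
weight true  false false = 1 ·m+ 2
weight false true  false = 1 ·m+ 1
weight false false false = 0 ·m+ 0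

-- Truth tables of the rowwise comparisons for W = u, for x ∈ W, and for x ∉ W; e₀ marks the
-- element i₀ at which W differs from v, resp. fails to lie between v and u.
rows-at-u : Vec Bool 3 → Bool
rows-at-u (a ∷ b ∷ ex ∷ []) = (ex →ᵇ a ∧ not b) →ᵇ
  (row (weight a b ex) b a e ≤ᵃ row (weight a b ex) a b e′) ∧
  (row (weight a b ex) a b e′ ≤ᵃ row (weight a b ex) b a e)
  where
  e e′ : Affine
  e  = (0 ·m+ 1) ⊛ (a ∧ not b)
  e′ = (1 ·m+ 0) ⊛ ex

rows-containing-x : Vec Bool 5 → Bool
rows-containing-x (a ∷ b ∷ c ∷ ex ∷ e₀ ∷ []) =
  (ex →ᵇ a ∧ not b) →ᵇ (ex →ᵇ c) →ᵇ (e₀ →ᵇ a ∧ not c) →ᵇ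
    row (weight a b ex) c a ((0 ·m+ 1) ⊛ e₀) ≤ᵃ row (weight a b ex) a c (0 ·m+ 0)

rows-avoiding-x : Vec Bool 5 → Bool
rows-avoiding-x (a ∷ b ∷ c ∷ ex ∷ e₀ ∷ []) =
  (ex →ᵇ a ∧ not b) →ᵇ (ex →ᵇ not c) →ᵇ (e₀ →ᵇ not (between a b c)) →ᵇ
    row (weight a b ex) c a (shift ⊛ e₀) ≤ᵃ row (weight a b ex) a c ((1 ·m+ 0) ⊛ ex)

module MinimalBetween {n} (𝓑 : Subset n → Bool)
  (equicardinal : ∀ {X Y} → T (𝓑 X) → T (𝓑 Y) → count (lookup X) ≡ count (lookup Y))
  {v u : Subset n} {x : Fin n} (𝓑v : T (𝓑 v)) (𝓑u : T (𝓑 u))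
  (vx : lookup v x ≡ true) (ux : lookup u x ≡ false)
  (minimal : ∀ W → T (𝓑 W) → Between v u W → lookup W x ≡ false → count (u ∖ v) ≤ count (W ∖ v))
  where

  m : ℕ
  m = count (u ∖ v)

  w : Fin n → Affine
  w i = weight (lookup v i) (lookup u i) (i ≡ᵇ x)

  value : Subset n → ℕ
  value X = sum λ i → (w i ⊛ lookup X i) ⟨ m ⟩

  x∈v∖u : ∀ i → T ((i ≡ᵇ x) →ᵇ (v ∖ u) i)
  x∈v∖u = at-point (v ∖ u) (∖-intro {p = v} {q = u} vx ux)

  value-u : value u ≡ value v
  value-u = ℕ.≤-antisym
    (ℕ.+-cancelʳ-≤ m _ _ (subst₂ (λ a b → value u + a ≤ value v + b) E≡m E′≡m
      (compare-rows m w e e′ (lookup u) (lookup v) (equicardinal 𝓑u 𝓑v) (proj₁ ∘ rows))))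
    (ℕ.+-cancelʳ-≤ m _ _ (subst₂ (λ a b → value v + a ≤ value u + b) E′≡m E≡m
      (compare-rows m w e′ e (lookup v) (lookup u) (equicardinal 𝓑v 𝓑u) (proj₂ ∘ rows))))
    where
    e e′ : Fin n → Affine
    e  i = (0 ·m+ 1) ⊛ (v ∖ u) i
    e′ i = (1 ·m+ 0) ⊛ (i ≡ᵇ x)
    E≡m : sum (λ i → e i ⟨ m ⟩) ≡ m
    E≡m = trans (sum-⊛ (0 ·m+ 1) (v ∖ u) m)
                (trans (ℕ.*-identityˡ _) (count-∖-sym v u (equicardinal 𝓑v 𝓑u)))
    E′≡m : sum (λ i → e′ i ⟨ m ⟩) ≡ m
    E′≡m = trans (sum-⊛-point (1 ·m+ 0) x m) (trans (ℕ.+-identityʳ (1 * m)) (ℕ.*-identityˡ m))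
    rows : ∀ i → T (row (w i) (lookup u i) (lookup v i) (e i) ≤ᵃ row (w i) (lookup v i) (lookup u i) (e′ i))
                 × T (row (w i) (lookup v i) (lookup u i) (e′ i) ≤ᵃ row (w i) (lookup u i) (lookup v i) (e i))
    rows i = Equivalence.to Bool.T-∧
      (→ᵇ-elim (valid rows-at-u _ (lookup v i ∷ lookup u i ∷ (i ≡ᵇ x) ∷ [])) (x∈v∖u i))

  value-below-containing-x : ∀ W → T (𝓑 W) → W ≢ v → lookup W x ≡ true → value W < value v
  value-below-containing-x W 𝓑W W≢v Wx with any? (λ i → (v ∖ W) i ≟𝔹 true)
  ... | no none = ⊥-elim (W≢v (sym (⊆-equicardinal⇒≡ v W v⊆W (ℕ.≤-reflexive (equicardinal 𝓑W 𝓑v)))))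
    where
    v⊆W : lookup v ⊆ᵇ lookup W
    v⊆W i vi with lookup W i in Wi
    ... | true  = refl
    ... | false = ⊥-elim (none (i , ∖-intro {p = v} {q = W} vi Wi))
  ... | yes (i₀ , v∖Wi₀) = +suc≤+⇒< (value W) (value v) 0
    (subst₂ (λ a b → value W + a ≤ value v + b) (sum-⊛-point (0 ·m+ 1) i₀ m) (sum-zero {n})
      (compare-rows m w (λ i → (0 ·m+ 1) ⊛ (i ≡ᵇ i₀)) (λ _ → 0 ·m+ 0) (lookup W) (lookup v)
        (equicardinal 𝓑W 𝓑v) rows))
    where
    rows : RowwiseBelow w (λ i → (0 ·m+ 1) ⊛ (i ≡ᵇ i₀)) (λ _ → 0 ·m+ 0) (lookup W) (lookup v)
    rows i = →ᵇ-elim (→ᵇ-elim (→ᵇ-elim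
      (valid rows-containing-x _ (lookup v i ∷ lookup u i ∷ lookup W i ∷ (i ≡ᵇ x) ∷ (i ≡ᵇ i₀) ∷ []))
      (x∈v∖u i)) (at-point (lookup W) Wx i)) (at-point (v ∖ W) v∖Wi₀ i)

  value-below-avoiding-x : ∀ W → T (𝓑 W) → W ≢ u → lookup W x ≡ false → value W < value v
  value-below-avoiding-x W 𝓑W W≢u Wx with any? (λ i → between (lookup v i) (lookup u i) (lookup W i) ≟𝔹 false)
  ... | no none = ⊥-elim (W≢u (sym (⊆-equicardinal⇒≡ u W u⊆W (ℕ.≤-reflexive (equicardinal 𝓑W 𝓑u)))))
    where
    btw : Between v u W
    btw i with between (lookup v i) (lookup u i) (lookup W i) in b
    ... | true  = _
    ... | false = ⊥-elim (none (i , b))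
    W∖v⊆u∖v : (W ∖ v) ⊆ᵇ (u ∖ v)
    W∖v⊆u∖v i = between-∖ (lookup v i) (lookup u i) (lookup W i) (btw i)
    u⊆W : lookup u ⊆ᵇ lookup W
    u⊆W i = between-⊇ (lookup v i) (lookup u i) (lookup W i) (btw i)
              (⊆ᵇ-reverse W∖v⊆u∖v (minimal W 𝓑W btw Wx) i)
  ... | yes (i₀ , ¬btw) = +suc≤+⇒< (value W) (value v) ((1 ·m+ 0) ⟨ m ⟩)
    (subst₂ (λ a b → value W + a ≤ value v + b)
      (trans (sum-⊛-point shift i₀ m) (ℕ.+-suc (1 * m) 0)) (sum-⊛-point (1 ·m+ 0) x m)
      (compare-rows m w (λ i → shift ⊛ (i ≡ᵇ i₀)) (λ i → (1 ·m+ 0) ⊛ (i ≡ᵇ x)) (lookup W) (lookup v)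
        (equicardinal 𝓑W 𝓑v) rows))
    where
    rows : RowwiseBelow w (λ i → shift ⊛ (i ≡ᵇ i₀)) (λ i → (1 ·m+ 0) ⊛ (i ≡ᵇ x)) (lookup W) (lookup v)
    rows i = →ᵇ-elim (→ᵇ-elim (→ᵇ-elim
      (valid rows-avoiding-x _ (lookup v i ∷ lookup u i ∷ lookup W i ∷ (i ≡ᵇ x) ∷ (i ≡ᵇ i₀) ∷ []))
      (x∈v∖u i)) (at-point (λ i → not (lookup W i)) (cong not Wx) i))
      (at-point (λ i → not (between (lookup v i) (lookup u i) (lookup W i))) (cong not ¬btw) i)

  value-below : ∀ W → T (𝓑 W) → W ≢ v → W ≢ u → value W < value v
  value-below W 𝓑W W≢v W≢u with lookup W x in Wx
  ... | true  = value-below-containing-x W 𝓑W W≢v Wx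
  ... | false = value-below-avoiding-x W 𝓑W W≢u Wx

  edge : IsEdge 𝓑 v u
  edge = c , trans (dot-c v) (trans (cong fromℕ (sym value-u)) (sym (dot-c u))) ,
         λ Z 𝓑Z Z≢v Z≢u →
           subst₂ _<ℚ_ (sym (dot-c Z)) (sym (dot-c v)) (fromℕ-mono-< (value-below Z 𝓑Z Z≢v Z≢u))
    where
    c : Vec ℚ n
    c = tabulate λ i → fromℕ (w i ⟨ m ⟩)
    dot-c : ∀ X → dot c (incidence X) ≡ fromℕ (value X)
    dot-c X = trans (dot-fromℕ (λ i → w i ⟨ m ⟩) X)
                    (cong fromℕ (sym (sum-cong-≗ (λ i → ⊛-⟨⟩ (w i) (lookup X i) m))))

-- The base graph of a matroid is the 1-skeleton of its base polytope

adjacent⇒edge : ∀ {n} (N : Matroid n) {B B′} → IsBase N B → IsBase N B′ → Adjacent B B′ →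
  IsEdge (isBase N) B B′
adjacent⇒edge N {B} {B′} bB bB′ adj with adjacent⇒counts B B′ (bases-equicardinal N bB bB′) adj
... | one-out , one-in with count>0⇒∃ {p = B ∖ B′} (subst (0 <_) (sym one-out) (s≤s z≤n))
... | x , B∖B′x = MinimalBetween.edge (isBase N) (bases-equicardinal N) bB bB′ Bx B′x minimal
  where
  Bx : lookup B x ≡ true
  Bx = proj₁ (∖-elim {p = B} {q = B′} B∖B′x)
  B′x : lookup B′ x ≡ false
  B′x = proj₂ (∖-elim {p = B} {q = B′} B∖B′x)
  minimal : ∀ W → IsBase N W → Between B B′ W → lookup W x ≡ false → count (B′ ∖ B) ≤ count (W ∖ B)
  minimal W bW _ Wx with count (W ∖ B) in W∖B
  ... | suc _ = ℕ.≤-trans (ℕ.≤-reflexive one-in) (s≤s z≤n)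
  ... | zero  = ⊥-elim (Bool.not-¬ Bx (trans (cong (λ X → lookup X x) (sym W≡B)) Wx))
    where
    W≡B : W ≡ B
    W≡B = ⊆-equicardinal⇒≡ W B (∖-empty⇒⊆ {p = W} {q = B} W∖B) (ℕ.≤-reflexive (bases-equicardinal N bB bW))

cheaper-exchange : ∀ {n} (N : Matroid n) (c : Vec ℚ n) {B B′} → IsBase N B → IsBase N B′ →
  ¬ Adjacent B B′ →
  (∀ Z → IsBase N Z → Z ≢ B → Z ≢ B′ → dot c (incidence Z) <ℚ dot c (incidence B)) →
  ∀ {e} → lookup B e ≡ true → lookup B′ e ≡ false →
  ∃ λ y → (B′ ∖ B) y ≡ true × lookup c y <ℚ lookup c e
cheaper-exchange N c {B} {B′} bB bB′ ¬adj below {e} Be B′e with exchange′ N bB bB′ Be B′e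
... | y , B′y , By , bZ = y , ∖-intro {p = B′} {q = B} B′y By , ℚ.≰⇒> cₑ≰cᵧ
  where
  open Replace B Be By
  Z : Subset _
  Z = replace B e y
  Z≢B : Z ≢ B
  Z≢B Z≡B = Bool.not-¬ Be (trans (cong (λ X → lookup X e) (sym Z≡B)) replace-∌)
  Z≢B′ : Z ≢ B′
  Z≢B′ Z≡B′ = ¬adj (subst (Adjacent B) Z≡B′ replace-adjacent)
  cₑ≰cᵧ : ¬ (lookup c e ≤ℚ lookup c y)
  cₑ≰cᵧ cₑ≤cᵧ = ℚ.<-irrefl refl (begin-strict
    dot c (incidence Z) +ℚ lookup c e <⟨ ℚ.+-monoˡ-< (lookup c e) (below Z bZ Z≢B Z≢B′) ⟩
    dot c (incidence B) +ℚ lookup c e ≤⟨ ℚ.+-monoʳ-≤ (dot c (incidence B)) cₑ≤cᵧ ⟩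
    dot c (incidence B) +ℚ lookup c y ≡⟨ dot-replace c B Be By ⟨
    dot c (incidence Z) +ℚ lookup c e ∎)
    where open ℚ.≤-Reasoning

edge⇒adjacent : ∀ {n} (N : Matroid n) {B B′} → IsBase N B → IsBase N B′ → B ≢ B′ →
  IsEdge (isBase N) B B′ → Adjacent B B′
edge⇒adjacent {n} N {B} {B′} bB bB′ B≢B′ (c , tie , below) with ∣ B ─ B′ ∣ + ∣ B′ ─ B ∣ ℕ.≟ 2
... | yes adj = adj
... | no ¬adj = no-minimum (argmin ℚ.≤-totalPreorder Δ (lookup c) (symmetric-difference-nonempty B≢B′))
  where
  Δ : Fin n → Bool
  Δ i = (B ∖ B′) i ∨ (B′ ∖ B) i
  below′ : ∀ Z → IsBase N Z → Z ≢ B′ → Z ≢ B → dot c (incidence Z) <ℚ dot c (incidence B′)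
  below′ Z bZ Z≢B′ Z≢B = subst (dot c (incidence Z) <ℚ_) tie (below Z bZ Z≢B Z≢B′)
  descent : ∀ {e} → Δ e ≡ true → ∃ λ y → Δ y ≡ true × lookup c y <ℚ lookup c e
  descent {e} Δe with (B ∖ B′) e in B∖B′e
  ... | true with cheaper-exchange N c bB bB′ ¬adj below
                    (proj₁ (∖-elim {p = B} {q = B′} B∖B′e)) (proj₂ (∖-elim {p = B} {q = B′} B∖B′e))
  ...   | y , B′∖By , cᵧ<cₑ = y , trans (cong ((B ∖ B′) y ∨_) B′∖By) (Bool.∨-zeroʳ _) , cᵧ<cₑ
  descent {e} Δe | false with cheaper-exchange N c bB′ bB (¬adj ∘ adjacent-sym {B = B′} {B′ = B}) below′
                    (proj₁ (∖-elim {p = B′} {q = B} Δe)) (proj₂ (∖-elim {p = B′} {q = B} Δe))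
  ...   | y , B∖B′y , cᵧ<cₑ = y , cong (_∨ (B′ ∖ B) y) B∖B′y , cᵧ<cₑ
  no-minimum : (∃ λ e → Δ e ≡ true × ∀ j → Δ j ≡ true → lookup c e ≤ℚ lookup c j) → Adjacent B B′
  no-minimum (e , Δe , minimal) with descent Δe
  ... | y , Δy , cᵧ<cₑ = ⊥-elim (ℚ.<-irrefl refl (ℚ.<-≤-trans cᵧ<cₑ (minimal y Δy)))

adjacent⇔edge : ∀ {n} (N : Matroid n) {B B′} → IsBase N B → IsBase N B′ → B ≢ B′ →
  Adjacent B B′ ⇔ IsEdge (isBase N) B B′
adjacent⇔edge N bB bB′ B≢B′ = mk⇔ (adjacent⇒edge N bB bB′) (edge⇒adjacent N bB bB′ B≢B′)

base-cobase-exchange : ∀ {n} (M : Matroid n) → ConditionII M →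
  ∀ B₁ B₂ → T (isBaseCobase M B₁) → T (isBaseCobase M B₂) → ∀ x → x ∈ B₁ → x ∉ B₂ →
  ∃ λ y → y ∈ B₂ × y ∉ B₁ × T (isBaseCobase M (replace B₁ x y))
base-cobase-exchange {n} M skeleton B₁ B₂ b₁ b₂ x x∈B₁ x∉B₂
  with any? (λ y → ((B₂ ∖ B₁) y ∧ isBaseCobase M (replace B₁ x y)) ≟𝔹 true)
... | yes (y , found) = y , lookup⇒∈ B₂y , lookup⇒∉ B₁y , Equivalence.from Bool.T-≡ (proj₂ parts)
  where
  parts : (B₂ ∖ B₁) y ≡ true × isBaseCobase M (replace B₁ x y) ≡ true
  parts = ∧-true ((B₂ ∖ B₁) y) (isBaseCobase M (replace B₁ x y)) found
  B₂y : lookup B₂ y ≡ true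
  B₂y = proj₁ (∖-elim {p = B₂} {q = B₁} (proj₁ parts))
  B₁y : lookup B₁ y ≡ false
  B₁y = proj₂ (∖-elim {p = B₂} {q = B₁} (proj₁ parts))
... | no none = ⊥-elim (descend B₂ (On.wellFounded (λ u → count (u ∖ B₁)) <-wellFounded B₂) b₂
                  (λ i → between-refl (lookup B₁ i) (lookup B₂ i)) (∉⇒lookup x∉B₂))
  where
  equicardinal : ∀ {X Y} → T (isBaseCobase M X) → T (isBaseCobase M Y) →
    count (lookup X) ≡ count (lookup Y)
  equicardinal bX bY =
    bases-equicardinal M (proj₁ (Equivalence.to Bool.T-∧ bX)) (proj₁ (Equivalence.to Bool.T-∧ bY))
  B₁x : lookup B₁ x ≡ true
  B₁x = ∈⇒lookup x∈B₁
  descend : ∀ u → Acc (_<_ on (λ u → count (u ∖ B₁))) u → T (isBaseCobase M u) → Between B₁ B₂ u →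
    lookup u x ≡ false → ⊥
  descend u (acc smaller) bu btw ux =
    exchange-found (adjacent⇒replace B₁ u (equicardinal b₁ bu) adjacent B₁x ux)
    where
    minimal : ∀ W → T (isBaseCobase M W) → Between B₁ u W → lookup W x ≡ false →
      count (u ∖ B₁) ≤ count (W ∖ B₁)
    minimal W bW btw′ Wx = ℕ.≮⇒≥ λ W⊏u → descend W (smaller W⊏u) bW
      (λ i → between-trans (lookup B₁ i) (lookup B₂ i) (lookup u i) (lookup W i) (btw i) (btw′ i)) Wx
    B₁≢u : B₁ ≢ u
    B₁≢u B₁≡u = Bool.not-¬ B₁x (trans (cong (λ X → lookup X x) B₁≡u) ux)
    adjacent : Adjacent B₁ u
    adjacent = Equivalence.from (skeleton B₁ u b₁ bu B₁≢u)
                 (MinimalBetween.edge (isBaseCobase M) equicardinal b₁ bu B₁x ux minimal)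
    exchange-found : (∃ λ y → lookup u y ≡ true × lookup B₁ y ≡ false × u ≡ replace B₁ x y) → ⊥
    exchange-found (y , uy , B₁y , u≡) = none (y , cong₂ _∧_
      (between-∖ (lookup B₁ y) (lookup B₂ y) (lookup u y) (btw y) (∖-intro {p = u} {q = B₁} uy B₁y))
      (Equivalence.to Bool.T-≡ (subst (T ∘ isBaseCobase M) u≡ bu)))

I⇒II : ∀ {n} (M : Matroid n) → ConditionI M → ConditionII M
I⇒II M (N , bases≡) B B′ bB bB′ B≢B′ = mk⇔ (IsEdge-cong bases≡ ∘ to) (from ∘ IsEdge-cong (sym ∘ bases≡))
  where
  base : ∀ {X} → T (isBaseCobase M X) → IsBase N X
  base {X} = subst T (sym (bases≡ X))
  open Equivalence (adjacent⇔edge N (base bB) (base bB′) B≢B′)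

II⇒I : ∀ {n} (M : Matroid n) → IsBlockMatroid M → ConditionII M → ConditionI M
II⇒I M block skeleton = N , λ _ → refl
  where
  N : Matroid _
  N = record { isBase = isBaseCobase M ; nonempty = block ; exchange = base-cobase-exchange M skeleton }

base-cobase-∁ : ∀ {n} (M : Matroid n) X → isBaseCobase M (∁ X) ≡ isBaseCobase M X
base-cobase-∁ M X =
  trans (cong (isBase M (∁ X) ∧_) (cong (isBase M) ∁∁X)) (Bool.∧-comm (isBase M (∁ X)) (isBase M X))
  where
  ∁∁X : ∁ (∁ X) ≡ X
  ∁∁X = lookup-ext λ i → trans (lookup-∁ (∁ X) i) (trans (cong not (lookup-∁ X i)) (Bool.not-involutive _))

I⇒III : ∀ {n} (M : Matroid n) → ConditionI M → ConditionIII M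
I⇒III M (N , bases≡) = N , self-dual , bases⊆ , base-cobases≡
  where
  self-dual : IdenticallySelfDual N
  self-dual X = trans (bases≡ X) (trans (sym (base-cobase-∁ M X)) (sym (bases≡ (∁ X))))
  bases⊆ : ∀ X → T (isBase N X) → T (isBase M X)
  bases⊆ X bX = proj₁ (Equivalence.to Bool.T-∧ (subst T (bases≡ X) bX))
  base-cobases≡ : ∀ X → isBaseCobase N X ≡ isBaseCobase M X
  base-cobases≡ X = trans (cong₂ _∧_ (bases≡ X) (trans (bases≡ (∁ X)) (base-cobase-∁ M X))) (Bool.∧-idem _)

III⇒I : ∀ {n} (M : Matroid n) → ConditionIII M → ConditionI M
III⇒I M (N , self-dual , _ , base-cobases≡) = N , λ X →
  trans (sym (trans (cong (isBase N X ∧_) (sym (self-dual X))) (Bool.∧-idem _))) (base-cobases≡ X)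

lemma2p5 : ∀ {n : ℕ} (M : Matroid n) → IsBlockMatroid M →
    (ConditionI M ⇔ ConditionII M) × (ConditionII M ⇔ ConditionIII M)
lemma2p5 M block =
  mk⇔ (I⇒II M) (II⇒I M block) ,
  mk⇔ (I⇒III M ∘ II⇒I M block) (I⇒II M ∘ III⇒I M)
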